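{- Let $i,j$ be integers with $i\geq1$ and $0\le j\le i$. If $\mathcal{F}_{i,j}$ contains a planar graph of girth at least five, then $i\geq 5$.
   Context: For a multigraph $G$, edges $e_1,e_2\in E(G)$ (not necessarily distinct) and a vertex $a$ of degree two, $G\circ(e_1,e_2,a)$ is the multigraph obtained from $G$ by subdividing $e_1$ and $e_2$ once each (if $e_1=e_2$ this edge is subdivided twice) and adding a new vertex adjacent to $a$ and to the two new subdivision vertices. Define $\mathcal{F}_{1,0}$ to consist of the multigraph on one vertex with one loop, and $\mathcal{F}_{i,j}=\emptyset$ if $i\leq 0$ or $j<0$. For $0\leq j\leq i$ (other than $(i,j)=(1,0)$), $\mathcal{F}_{i,j}$ is the set of subcubic multigraphs (every vertex of degree at most three, loops counting twice) obtained either from a member of $\mathcal{F}_{i-1,j}$ by subdividing one edge once, or from a member of $\mathcal{F}_{i,j-1}$ by an operation $\circ$. The girth of a graph is the length of a shortest cycle. -}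

module Defs where

open import Data.Nat using (ℕ; zero; suc; _+_; _*_; _≤_; _<_; _≤ᵇ_)
open import Data.Fin using (Fin; zero; suc; toℕ; inject₁; fromℕ; _≟_)
open import Data.Bool using (Bool; true; false; not; if_then_else_)
open import Data.Product using (Σ; ∃; _×_; _,_; proj₁; proj₂)
open import Data.Sum using (_⊎_)
open import Data.List using (List; []; _∷_; map; allFin; upTo; concatMap; length; filterᵇ)
open import Data.Nat.ListAction using (sum)
open import Data.Bool.ListAction using (all)
open import Relation.Nullary using (¬_; does)
open import Relation.Binary.PropositionalEquality using (_≡_)
open import Relation.Binary.Construct.Closure.ReflexiveTransitive using (Star)

-- Finite multigraphs: vertices Fin n, edges Fin m, each edge has two
-- (not necessarily distinct) ends.  A loop is an edge with equal ends.

record Graph : Set where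
  field
    n    : ℕ
    m    : ℕ
    ends : Fin m → Fin n × Fin n

open Graph public

Vertex : Graph → Set
Vertex G = Fin (n G)

Edge : Graph → Set
Edge G = Fin (m G)

Joins : (G : Graph) → Edge G → Vertex G → Vertex G → Set
Joins G e u w = (ends G e ≡ (u , w)) ⊎ (ends G e ≡ (w , u))

eqᵇ : ∀ {k} → Fin k → Fin k → ℕ
eqᵇ u v = if does (u ≟ v) then 1 else 0

-- degree; a loop counts twice
deg : (G : Graph) → Vertex G → ℕ
deg G v = sum (map (λ e → eqᵇ (proj₁ (ends G e)) v + eqᵇ (proj₂ (ends G e)) v) (allFin (m G)))

Subcubic : Graph → Set
Subcubic G = ∀ v → deg G v ≤ 3

-- Operations.  New vertices / edges are put at index zero, old ones are
-- shifted by suc.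

subdivide : (G : Graph) → Edge G → Graph
subdivide G e = record { n = suc (n G) ; m = suc (m G) ; ends = ends' }
  where
  ends' : Fin (suc (m G)) → Fin (suc (n G)) × Fin (suc (n G))
  ends' zero = (zero , suc (proj₂ (ends G e)))
  ends' (suc f) = if does (f ≟ e)
                  then (suc (proj₁ (ends G e)) , zero)
                  else (suc (proj₁ (ends G f)) , suc (proj₂ (ends G f)))

-- G ∘ (e₁, e₂, a): subdivide e₁ (new vertex x), then subdivide e₂ (new
-- vertex y); if e₁ = e₂ the second subdivision is applied to the piece
-- (x,w) of e₁, so that e₁ is subdivided twice.  Finally add a vertex z
-- adjacent to a, x and y.
circ : (G : Graph) → Edge G → Edge G → Vertex G → Graph
circ G e₁ e₂ a = record { n = suc (n G₂) ; m = suc (suc (suc (m G₂))) ; ends = ends₃ }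
  where
  G₁ : Graph
  G₁ = subdivide G e₁
  e₂' : Edge G₁
  e₂' = if does (e₁ ≟ e₂) then zero else suc e₂
  G₂ : Graph
  G₂ = subdivide G₁ e₂'
  -- in G₂: y = zero, x = suc zero, a = suc (suc a)
  ends₃ : Fin (suc (suc (suc (m G₂)))) → Fin (suc (n G₂)) × Fin (suc (n G₂))
  ends₃ zero                = (zero , suc (suc (suc a)))
  ends₃ (suc zero)          = (zero , suc (suc zero))
  ends₃ (suc (suc zero))    = (zero , suc zero)
  ends₃ (suc (suc (suc f))) = (suc (proj₁ (ends G₂ f)) , suc (proj₂ (ends G₂ f)))

loopGraph : Graph
loopGraph = record { n = 1 ; m = 1 ; ends = λ _ → (zero , zero) }

-- Membership G ∈ 𝓕_{i,j} (for concrete representatives).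
data InF : ℕ → ℕ → Graph → Set where
  base : InF 1 0 loopGraph
  sub  : ∀ {i j G} → InF i j G → (e : Edge G) →
         Subcubic (subdivide G e) → InF (suc i) j (subdivide G e)
  op   : ∀ {i j G} → InF i j G → suc j ≤ i →
         (e₁ e₂ : Edge G) (a : Vertex G) → deg G a ≡ 2 →
         Subcubic (circ G e₁ e₂ a) → InF i (suc j) (circ G e₁ e₂ a)

-- Loops are cycles of length 1, parallel edges
-- give cycles of length 2.

record Cycle (G : Graph) (k : ℕ) : Set where
  field
    vs     : Fin (suc k) → Vertex G
    es     : Fin (suc k) → Edge G
    vs-inj : ∀ s t → vs s ≡ vs t → s ≡ t
    es-inj : ∀ s t → es s ≡ es t → s ≡ t
    step   : ∀ (t : Fin k) → Joins G (es (inject₁ t)) (vs (inject₁ t)) (vs (suc t))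
    close  : Joins G (es (fromℕ k)) (vs (fromℕ k)) (vs zero)

GirthAtLeast : ℕ → Graph → Set
GirthAtLeast g G = ∀ k → suc k < g → ¬ Cycle G k

-- Planarity via rotation systems (combinatorial embeddings):
-- G is planar iff it has a rotation system of Euler genus 0, i.e.
-- |V| - |E| + |F| + #isolated = 2 · #components.

Dart : Graph → Set
Dart G = Edge G × Bool

head : (G : Graph) → Dart G → Vertex G
head G (e , false) = proj₁ (ends G e)
head G (e , true)  = proj₂ (ends G e)

θ : (G : Graph) → Dart G → Dart G
θ G (e , b) = (e , not b)

key : (G : Graph) → Dart G → ℕ
key G (e , b) = 2 * toℕ e + (if b then 1 else 0)

allDarts : (G : Graph) → List (Dart G)
allDarts G = concatMap (λ e → (e , false) ∷ (e , true) ∷ []) (allFin (m G))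

iter : {A : Set} → (A → A) → ℕ → A → A
iter f zero    x = x
iter f (suc k) x = f (iter f k x)

record Rotation (G : Graph) : Set where
  field
    σ        : Dart G → Dart G
    σ-inj    : ∀ d d' → σ d ≡ σ d' → d ≡ d'
    σ-local  : ∀ d → head G (σ d) ≡ head G d
    σ-cyclic : ∀ d d' → head G d ≡ head G d' → ∃ λ k → iter σ k d ≡ d'

-- face permutation φ = σ ∘ θ; faces = its orbits, counted by their
-- key-minimal representatives.
faces : (G : Graph) → Rotation G → ℕ
faces G R = length (filterᵇ isRep (allDarts G))
  where
  φ : Dart G → Dart G
  φ d = Rotation.σ R (θ G d)
  isRep : Dart G → Bool
  isRep d = all (λ k → key G d ≤ᵇ key G (iter φ k d)) (upTo (2 * m G))

isolated : Graph → ℕ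
isolated G = length (filterᵇ (λ v → does (deg G v Data.Nat.≟ 0)) (allFin (n G)))

Adj : (G : Graph) → Vertex G → Vertex G → Set
Adj G u w = ∃ λ e → Joins G e u w

record Components (G : Graph) : Set where
  field
    c         : ℕ
    label     : Vertex G → Fin c
    surj      : ∀ k → ∃ λ v → label v ≡ k
    respects  : ∀ u w → Adj G u w → label u ≡ label w
    connected : ∀ u w → label u ≡ label w → Star (Adj G) u w

Planar : Graph → Set
Planar G = Σ (Rotation G) λ R → Σ (Components G) λ C →
  n G + faces G R + isolated G ≡ m G + 2 * Components.c C

-- Members of 𝓕 i j have i + 3j vertices, i + 5j edges and minimum degree two.  In a rotation
-- system of such a graph with girth at least five, a face walk closing up after at most four steps
-- would yield a loop, two parallel edges, a triangle or a square, so every face has length at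
-- least five and 5f ≤ 2m.  Euler's formula n + f = m + 2c with c ≥ 1 then gives 10 ≤ 10c ≤ 2i.
module Submission where

open import Defs
open import Data.Bool using (Bool; true; false; T; if_then_else_)
open import Data.Bool.Properties using (not-injective)
open import Data.Bool.ListAction using (all)
open import Data.Empty using (⊥; ⊥-elim)
open import Data.Fin using (Fin; zero; suc; toℕ; fromℕ<; combine; remQuot; _≟_)
open import Data.Fin.Properties
  using (suc-injective; toℕ-injective; toℕ<n; toℕ-inject₁; toℕ-fromℕ; toℕ-combine;
         combine-injective; combine-remQuot; pigeonhole; injective⇒≤)
open import Data.List using (List; []; _∷_; length; lookup; concatMap; filterᵇ; allFin; upTo)
open import Data.List.Membership.Propositional using (_∈_)
open import Data.List.Membership.Propositional.Properties using (∈-lookup; ∈-upTo⁺; ∈-map⁺; ∈-allFin)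
open import Data.List.Properties using (filter-none)
open import Data.List.Relation.Unary.All as All using (All; []; _∷_)
open import Data.List.Relation.Unary.All.Properties using (all⁺; all-filter)
open import Data.List.Relation.Unary.AllPairs using ([]; _∷_)
open import Data.List.Relation.Unary.Any using (here; there)
open import Data.List.Relation.Unary.Unique.Propositional using (Unique)
open import Data.List.Relation.Unary.Unique.Propositional.Properties using (allFin⁺; filter⁺)
open import Data.Nat using (ℕ; zero; suc; _+_; _*_; _∸_; _≤_; _<_; _≤ᵇ_; _<?_; z≤n; s≤s; z<s)
open import Data.Nat.ListAction using (sum)
open import Data.Nat.Properties
  using (≤-refl; ≤-trans; ≤-antisym; ≤-total; <-cmp; ≤-pred; <⇒≤; ≮⇒≥; <-≤-trans; ≤-<-trans; n<1+n;
         m<n⇒m<1+n; m≤n⇒m<n∨m≡n; ≤ᵇ⇒≤; m≤m+n; m≤n+m; +-identityʳ; +-monoʳ-≤; +-cancelˡ-≤;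
         *-comm; *-distribˡ-+; *-monoʳ-≤; *-cancelˡ-≤; m+[n∸m]≡n; m∸n+n≡m; m∸n≤m; m<n⇒0<n∸m;
         m∸n≡0⇒m≤n; ∸-monoʳ-<; module ≤-Reasoning)
open import Data.Nat.Tactic.RingSolver using (solve-∀)
open import Data.Product using (∃; ∃₂; _×_; _,_; proj₁; proj₂; uncurry)
open import Data.Sum using (_⊎_; inj₁; inj₂)
open import Function using (_∘_)
open import Relation.Binary.Definitions using (tri<; tri≈; tri>)
open import Relation.Binary.PropositionalEquality
open import Relation.Nullary using (¬_; yes; no; does; T?)

module _ {A : Set} {f : A → A} where

  iter-+ : ∀ a b x → iter f (a + b) x ≡ iter f a (iter f b x)
  iter-+ zero    b x = refl
  iter-+ (suc a) b x = cong f (iter-+ a b x)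

  iter-fixed : ∀ {x} → f x ≡ x → ∀ k → iter f k x ≡ x
  iter-fixed fx zero    = refl
  iter-fixed fx (suc k) = trans (cong f (iter-fixed fx k)) fx

  module _ (f-injective : ∀ {x y} → f x ≡ f y → x ≡ y) where

    iter-injective : ∀ k {x y} → iter f k x ≡ iter f k y → x ≡ y
    iter-injective zero    eq = eq
    iter-injective (suc k) eq = iter-injective k (f-injective eq)

    iter-cancelˡ : ∀ {t s x y} → t ≤ s → iter f t x ≡ iter f s y → x ≡ iter f (s ∸ t) y
    iter-cancelˡ {t} {s} {x} {y} t≤s eq = iter-injective t (begin
      iter f t x                   ≡⟨ eq ⟩
      iter f s y                   ≡⟨ cong (λ k → iter f k y) (sym (m+[n∸m]≡n t≤s)) ⟩
      iter f (t + (s ∸ t)) y       ≡⟨ iter-+ t (s ∸ t) y ⟩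
      iter f t (iter f (s ∸ t) y)  ∎)
      where open ≡-Reasoning

  iter-complement : ∀ {p u x} → iter f p x ≡ x → u ≤ p → iter f (p ∸ u) (iter f u x) ≡ x
  iter-complement {p} {u} {x} fp u≤p = begin
    iter f (p ∸ u) (iter f u x)  ≡⟨ iter-+ (p ∸ u) u x ⟨
    iter f (p ∸ u + u) x         ≡⟨ cong (λ k → iter f k x) (m∸n+n≡m u≤p) ⟩
    iter f p x                   ≡⟨ fp ⟩
    x                            ∎
    where open ≡-Reasoning

lookup-injective : ∀ {A : Set} {xs : List A} → Unique xs →
                   ∀ i j → lookup xs i ≡ lookup xs j → i ≡ j
lookup-injective (_ ∷ _)  zero    zero    _  = refl
lookup-injective (x∉ ∷ _) zero    (suc j) eq = ⊥-elim (All.lookup x∉ (∈-lookup j) eq)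
lookup-injective (x∉ ∷ _) (suc i) zero    eq = ⊥-elim (All.lookup x∉ (∈-lookup i) (sym eq))
lookup-injective (_ ∷ u)  (suc i) (suc j) eq = cong suc (lookup-injective u i j eq)

∈⇒≤sum : ∀ {x xs} → x ∈ xs → x ≤ sum xs
∈⇒≤sum (here refl) = m≤m+n _ _
∈⇒≤sum (there x∈)  = ≤-trans (∈⇒≤sum x∈) (m≤n+m _ _)

θ-injective : ∀ {G d d'} → θ G d ≡ θ G d' → d ≡ d'
θ-injective eq = cong₂ _,_ (cong proj₁ eq) (not-injective (cong proj₂ eq))

sameEdge⇒≡∨θ : ∀ {G} (d d' : Dart G) → proj₁ d ≡ proj₁ d' → d' ≡ d ⊎ d' ≡ θ G d
sameEdge⇒≡∨θ (e , false) (.e , false) refl = inj₁ refl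
sameEdge⇒≡∨θ (e , false) (.e , true)  refl = inj₂ refl
sameEdge⇒≡∨θ (e , true)  (.e , false) refl = inj₂ refl
sameEdge⇒≡∨θ (e , true)  (.e , true)  refl = inj₁ refl

bitIndex : Bool → Fin 2
bitIndex false = zero
bitIndex true  = suc zero

bitIndex-injective : ∀ {b b'} → bitIndex b ≡ bitIndex b' → b ≡ b'
bitIndex-injective {false} {false} _ = refl
bitIndex-injective {true}  {true}  _ = refl

dartIndex : (G : Graph) → Dart G → Fin (m G * 2)
dartIndex G (e , b) = combine e (bitIndex b)

dartIndex-injective : ∀ {G} {d d' : Dart G} → dartIndex G d ≡ dartIndex G d' → d ≡ d'
dartIndex-injective {d = e , b} {e' , b'} eq with combine-injective e (bitIndex b) e' (bitIndex b') eq
... | refl , b≡b' = cong (e ,_) (bitIndex-injective b≡b')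

key≡toℕ∘dartIndex : ∀ {G} (d : Dart G) → key G d ≡ toℕ (dartIndex G d)
key≡toℕ∘dartIndex (e , false) = sym (toℕ-combine e zero)
key≡toℕ∘dartIndex (e , true)  = sym (toℕ-combine e (suc zero))

key-injective : ∀ {G} {d d' : Dart G} → key G d ≡ key G d' → d ≡ d'
key-injective {G} {d} {d'} eq = dartIndex-injective {G} (toℕ-injective (begin
  toℕ (dartIndex G d)   ≡⟨ key≡toℕ∘dartIndex {G} d ⟨
  key G d               ≡⟨ eq ⟩
  key G d'              ≡⟨ key≡toℕ∘dartIndex {G} d' ⟩
  toℕ (dartIndex G d')  ∎))
  where open ≡-Reasoning

joins-head-θ : ∀ {G} (d : Dart G) → Joins G (proj₁ d) (head G d) (head G (θ G d))
joins-head-θ (e , false) = inj₁ refl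
joins-head-θ (e , true)  = inj₂ refl

joins-ends : ∀ {G e a b c d} → Joins G e a b → Joins G e c d → (a ≡ c × b ≡ d) ⊎ (a ≡ d × b ≡ c)
joins-ends (inj₁ p) (inj₁ q) = inj₁ (cong proj₁ (trans (sym p) q) , cong proj₂ (trans (sym p) q))
joins-ends (inj₁ p) (inj₂ q) = inj₂ (cong proj₁ (trans (sym p) q) , cong proj₂ (trans (sym p) q))
joins-ends (inj₂ p) (inj₁ q) = inj₂ (cong proj₂ (trans (sym p) q) , cong proj₁ (trans (sym p) q))
joins-ends (inj₂ p) (inj₂ q) = inj₁ (cong proj₂ (trans (sym p) q) , cong proj₁ (trans (sym p) q))

TwoDartsAt : (G : Graph) → Vertex G → Set
TwoDartsAt G v = ∃₂ λ d d' → d ≢ d' × head G d ≡ v × head G d' ≡ v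

MinDegreeTwo : Graph → Set
MinDegreeTwo G = ∀ v → TwoDartsAt G v

TwoDartsAt-map : ∀ {G H} (ι : Dart G → Dart H) (ν : Vertex G → Vertex H) →
                 (∀ {d d'} → ι d ≡ ι d' → d ≡ d') →
                 (∀ d → head H (ι d) ≡ ν (head G d)) →
                 ∀ {v} → TwoDartsAt G v → TwoDartsAt H (ν v)
TwoDartsAt-map ι ν ι-injective head-ι (d , d' , d≢d' , refl , head-d'≡v) =
  ι d , ι d' , d≢d' ∘ ι-injective , head-ι d , trans (head-ι d') (cong ν head-d'≡v)

TwoDartsAt⇒1≤deg : ∀ {G v} → TwoDartsAt G v → 1 ≤ deg G v
TwoDartsAt⇒1≤deg {G} {v} ((e , b) , _ , _ , head≡v , _) =
  ≤-trans (1≤incidence b head≡v) (∈⇒≤sum (∈-map⁺ incidence (∈-allFin e)))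
  where
  incidence : Edge G → ℕ
  incidence f = eqᵇ (proj₁ (ends G f)) v + eqᵇ (proj₂ (ends G f)) v

  eqᵇ-≡ : ∀ {k} {u w : Fin k} → u ≡ w → eqᵇ u w ≡ 1
  eqᵇ-≡ {u = u} {w} u≡w with u ≟ w
  ... | yes _   = refl
  ... | no u≢w = ⊥-elim (u≢w u≡w)

  1≤incidence : ∀ b → head G (e , b) ≡ v → 1 ≤ incidence e
  1≤incidence false h =
    subst (λ x → 1 ≤ x + eqᵇ (proj₂ (ends G e)) v) (sym (eqᵇ-≡ h)) (m≤m+n 1 _)
  1≤incidence true h =
    subst (λ x → 1 ≤ eqᵇ (proj₁ (ends G e)) v + x) (sym (eqᵇ-≡ h)) (m≤n+m 1 _)

MinDegreeTwo⇒isolated≡0 : ∀ {G} → MinDegreeTwo G → isolated G ≡ 0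
MinDegreeTwo⇒isolated≡0 {G} two =
  cong length (filter-none (T? ∘ isolatedᵇ) {allFin (n G)} (All.tabulate λ {v} _ → not-isolated v))
  where
  isolatedᵇ : Vertex G → Bool
  isolatedᵇ v = does (deg G v Data.Nat.≟ 0)

  not-isolated : ∀ v → ¬ T (isolatedᵇ v)
  not-isolated v with deg G v | TwoDartsAt⇒1≤deg (two v)
  ... | suc _ | _ = λ ()

MinDegreeTwo⇒σ-fixed-point-free : ∀ {G} → MinDegreeTwo G → (R : Rotation G) →
                                  ∀ d → Rotation.σ R d ≢ d
MinDegreeTwo⇒σ-fixed-point-free {G} two R d σd≡d with two (head G d)
... | d₁ , d₂ , d₁≢d₂ , head₁ , head₂ = d₁≢d₂ (trans (sym (only-d d₁ head₁)) (only-d d₂ head₂))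
  where
  open Rotation R
  only-d : ∀ d' → head G d' ≡ head G d → d ≡ d'
  only-d d' same with σ-cyclic d d' (sym same)
  ... | k , σᵏd≡d' = trans (sym (iter-fixed σd≡d k)) σᵏd≡d'

-- A closed walk of length suc k; positions beyond suc k are irrelevant.
record ClosedWalk (G : Graph) (k : ℕ) : Set where
  field
    vertex : ℕ → Vertex G
    edge   : ℕ → Edge G
    step   : ∀ t → Joins G (edge t) (vertex t) (vertex (suc t))
    closed : vertex (suc k) ≡ vertex 0

  VerticesDistinct : Set
  VerticesDistinct = ∀ {s t} → s < t → t ≤ k → vertex s ≢ vertex t

  EdgesDistinct : Set
  EdgesDistinct = ∀ {s t} → s < t → t ≤ k → edge s ≢ edge t

injective-below : ∀ {A : Set} {k} (f : ℕ → A) → (∀ {s t} → s < t → t ≤ k → f s ≢ f t) →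
                  ∀ (s t : Fin (suc k)) → f (toℕ s) ≡ f (toℕ t) → s ≡ t
injective-below f distinct s t eq with <-cmp (toℕ s) (toℕ t)
... | tri< s<t _ _ = ⊥-elim (distinct s<t (≤-pred (toℕ<n t)) eq)
... | tri≈ _ s≡t _ = toℕ-injective s≡t
... | tri> _ _ t<s = ⊥-elim (distinct t<s (≤-pred (toℕ<n s)) (sym eq))

module _ {G k} (W : ClosedWalk G k) where
  open ClosedWalk W

  ClosedWalk⇒Cycle : VerticesDistinct → EdgesDistinct → Cycle G k
  ClosedWalk⇒Cycle vertices-distinct edges-distinct = record
    { vs     = vertex ∘ toℕ
    ; es     = edge ∘ toℕ
    ; vs-inj = injective-below vertex vertices-distinct
    ; es-inj = injective-below edge edges-distinct
    ; step   = λ t → subst (λ i → Joins G (edge i) (vertex i) (vertex (suc (toℕ t))))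
                           (sym (toℕ-inject₁ t)) (step (toℕ t))
    ; close  = subst (λ i → Joins G (edge i) (vertex i) (vertex 0)) (sym (toℕ-fromℕ k))
                     (subst (Joins G (edge k) (vertex k)) closed (step k))
    }

  -- A repeated edge forces a repeated vertex, except in the wrap-around case s = 0, t = k, where
  -- it forces vertex 1 = vertex k instead; 2 ≤ k makes that a repetition too.
  distinctVertices⇒distinctEdges : 2 ≤ k → VerticesDistinct → EdgesDistinct
  distinctVertices⇒distinctEdges 2≤k vertices-distinct {s} {t} s<t t≤k same
    with joins-ends {G} (step s) (subst (λ e → Joins G e (vertex t) (vertex (suc t))) (sym same) (step t))
  ... | inj₁ (vs≡vt , _) = vertices-distinct s<t t≤k vs≡vt
  ... | inj₂ (vs≡vt+1 , vs+1≡vt) with m≤n⇒m<n∨m≡n t≤k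
  ...   | inj₁ t<k = vertices-distinct (m<n⇒m<1+n s<t) t<k vs≡vt+1
  ...   | inj₂ refl with m≤n⇒m<n∨m≡n (z≤n {s})
  ...     | inj₁ 0<s  = vertices-distinct 0<s (<⇒≤ s<t) (sym (trans vs≡vt+1 closed))
  ...     | inj₂ refl = vertices-distinct 2≤k ≤-refl vs+1≡vt

-- Counting faces

dartsOf : ∀ {G} → List (Edge G) → List (Dart G)
dartsOf = concatMap (λ e → (e , false) ∷ (e , true) ∷ [])

dartsOf-unique : ∀ {G} {es : List (Edge G)} → Unique es → Unique (dartsOf {G} es)
dartsOf-unique                   []              = []
dartsOf-unique {G} {es = e ∷ _} (e∉ ∷ unique) =
  ((λ ()) ∷ fresh false e∉) ∷ fresh true e∉ ∷ dartsOf-unique {G} unique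
  where
  fresh : ∀ {es} b → All (e ≢_) es → All ((e , b) ≢_) (dartsOf {G} es)
  fresh b []          = []
  fresh b (e≢ ∷ e∉es) = (e≢ ∘ cong proj₁) ∷ (e≢ ∘ cong proj₁) ∷ fresh b e∉es

module _ (G : Graph) (R : Rotation G) where
  open Rotation R

  φ : Dart G → Dart G
  φ d = σ (θ G d)

  φ-injective : ∀ {d d'} → φ d ≡ φ d' → d ≡ d'
  φ-injective eq = θ-injective {G} (σ-inj _ _ eq)

  FaceLengthAtLeast : ℕ → Set
  FaceLengthAtLeast g = ∀ d k → suc k < g → iter φ (suc k) d ≢ d

  isFaceRepresentative : Dart G → Bool
  isFaceRepresentative d = all (λ k → key G d ≤ᵇ key G (iter φ k d)) (upTo (2 * m G))

  -- faces G R is by definition the length of this list.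
  representatives : List (Dart G)
  representatives = filterᵇ isFaceRepresentative (allDarts G)

  representatives-unique : Unique representatives
  representatives-unique = filter⁺ (T? ∘ isFaceRepresentative) (dartsOf-unique {G} (allFin⁺ (m G)))

  representative-lookup : ∀ i → T (isFaceRepresentative (lookup representatives i))
  representative-lookup i = All.lookup (all-filter (T? ∘ isFaceRepresentative) (allDarts G)) (∈-lookup i)

  representative-minimal : ∀ {d k} → T (isFaceRepresentative d) → k < 2 * m G →
                           key G d ≤ key G (iter φ k d)
  representative-minimal r k<2m = ≤ᵇ⇒≤ _ _ (All.lookup (all⁺ _ _ r) (∈-upTo⁺ k<2m))

  φ-period : ∀ d → ∃ λ p → 0 < p × p ≤ 2 * m G × iter φ p d ≡ d
  φ-period d with pigeonhole (n<1+n (m G * 2)) (λ i → dartIndex G (iter φ (toℕ i) d))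
  ... | i , j , i<j , same =
    toℕ j ∸ toℕ i , m<n⇒0<n∸m i<j , p≤2m ,
    sym (iter-cancelˡ φ-injective (<⇒≤ i<j) (dartIndex-injective {G} same))
    where
    p≤2m : toℕ j ∸ toℕ i ≤ 2 * m G
    p≤2m = ≤-trans (m∸n≤m (toℕ j) (toℕ i)) (subst (toℕ j ≤_) (*-comm (m G) 2) (≤-pred (toℕ<n j)))

  representatives-in-orbit : ∀ {a b p u} →
    T (isFaceRepresentative a) → T (isFaceRepresentative b) →
    iter φ p b ≡ b → p ≤ 2 * m G → u < p → a ≡ iter φ u b → a ≡ b
  representatives-in-orbit {u = zero} _ _ _ _ _ a≡b = a≡b
  representatives-in-orbit {a} {b} {p} {suc u} ra rb φᵖb≡b p≤2m u<p a≡φᵘb =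
    key-injective {G} (≤-antisym key-a≤key-b key-b≤key-a)
    where
    φᵖ⁻ᵘa≡b : iter φ (p ∸ suc u) a ≡ b
    φᵖ⁻ᵘa≡b = subst (λ x → iter φ (p ∸ suc u) x ≡ b) (sym a≡φᵘb) (iter-complement φᵖb≡b (<⇒≤ u<p))
    key-a≤key-b : key G a ≤ key G b
    key-a≤key-b = subst (λ x → key G a ≤ key G x) φᵖ⁻ᵘa≡b
      (representative-minimal ra (<-≤-trans (∸-monoʳ-< z<s (<⇒≤ u<p)) p≤2m))
    key-b≤key-a : key G b ≤ key G a
    key-b≤key-a = subst (λ x → key G b ≤ key G x) (sym a≡φᵘb)
      (representative-minimal rb (<-≤-trans u<p p≤2m))

  module _ {g} (long : FaceLengthAtLeast g) where

    long-period : ∀ d → ∃ λ p → g ≤ p × p ≤ 2 * m G × iter φ p d ≡ d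
    long-period d with φ-period d
    ... | suc k , _ , p≤2m , φᵖd≡d with suc k <? g
    ...   | yes 1+k<g = ⊥-elim (long d k 1+k<g φᵖd≡d)
    ...   | no  1+k≮g = suc k , ≮⇒≥ 1+k≮g , p≤2m , φᵖd≡d

    returns-only-at-0 : ∀ {u} d → u < g → iter φ u d ≡ d → u ≡ 0
    returns-only-at-0 {zero}  _ _   _   = refl
    returns-only-at-0 {suc k} d u<g ret = ⊥-elim (long d k u<g ret)

    same-orbit-position : ∀ {a b t s} → T (isFaceRepresentative a) → T (isFaceRepresentative b) →
      t ≤ s → s < g → iter φ t a ≡ iter φ s b → a ≡ b × t ≡ s
    same-orbit-position {a} {b} {t} {s} ra rb t≤s s<g eq with long-period b
    ... | p , g≤p , p≤2m , φᵖb≡b = a≡b , ≤-antisym t≤s (m∸n≡0⇒m≤n (returns-only-at-0 b s∸t<g φˢ⁻ᵗb≡b))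
      where
      s∸t<g : s ∸ t < g
      s∸t<g = ≤-<-trans (m∸n≤m s t) s<g
      a≡φˢ⁻ᵗb : a ≡ iter φ (s ∸ t) b
      a≡φˢ⁻ᵗb = iter-cancelˡ φ-injective t≤s eq
      a≡b : a ≡ b
      a≡b = representatives-in-orbit ra rb φᵖb≡b p≤2m (<-≤-trans s∸t<g g≤p) a≡φˢ⁻ᵗb
      φˢ⁻ᵗb≡b : iter φ (s ∸ t) b ≡ b
      φˢ⁻ᵗb≡b = trans (sym a≡φˢ⁻ᵗb) a≡b

    orbit-position-injective : ∀ {a b t s} → T (isFaceRepresentative a) → T (isFaceRepresentative b) →
      t < g → s < g → iter φ t a ≡ iter φ s b → a ≡ b × t ≡ s
    orbit-position-injective ra rb t<g s<g eq with ≤-total _ _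
    ... | inj₁ t≤s = same-orbit-position ra rb t≤s s<g eq
    ... | inj₂ s≤t with same-orbit-position rb ra s≤t t<g (sym eq)
    ...   | b≡a , s≡t = sym b≡a , sym s≡t

    -- A representative together with its first g iterates gives g distinct darts, and different
    -- representatives lie in different orbits.
    faces*g≤darts : faces G R * g ≤ m G * 2
    faces*g≤darts = injective⇒≤ {f = dartIndex G ∘ dartAt ∘ coordinates} position-injective
      where
      coordinates : Fin (length representatives * g) → Fin (length representatives) × Fin g
      coordinates = remQuot g

      dartAt : Fin (length representatives) × Fin g → Dart G
      dartAt (i , t) = iter φ (toℕ t) (lookup representatives i)

      dartAt-injective : ∀ c c' → dartAt c ≡ dartAt c' → c ≡ c'
      dartAt-injective (i , t) (i' , t') eq
        with orbit-position-injective (representative-lookup i) (representative-lookup i')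
               (toℕ<n t) (toℕ<n t') eq
      ... | same-rep , t≡t' = cong₂ _,_ (lookup-injective representatives-unique i i' same-rep)
                                        (toℕ-injective t≡t')

      position-injective : ∀ {k k'} →
        dartIndex G (dartAt (coordinates k)) ≡ dartIndex G (dartAt (coordinates k')) → k ≡ k'
      position-injective {k} {k'} eq = begin
        k                                  ≡⟨ combine-remQuot {length representatives} g k ⟨
        uncurry combine (coordinates k)    ≡⟨ cong (uncurry combine)
                                                   (dartAt-injective _ _ (dartIndex-injective {G} eq)) ⟩
        uncurry combine (coordinates k')   ≡⟨ combine-remQuot {length representatives} g k' ⟩
        k'                                 ∎
        where open ≡-Reasoning

  joins-head-φ : ∀ d → Joins G (proj₁ d) (head G d) (head G (φ d))
  joins-head-φ d = subst (Joins G (proj₁ d) (head G d)) (sym (σ-local (θ G d))) (joins-head-θ d)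

  faceWalk : ∀ d k → head G (iter φ (suc k) d) ≡ head G d → ClosedWalk G k
  faceWalk d k closed = record
    { vertex = λ t → head G (iter φ t d)
    ; edge   = λ t → proj₁ (iter φ t d)
    ; step   = λ t → joins-head-φ (iter φ t d)
    ; closed = closed
    }

  module _ (girth : GirthAtLeast 5 G) (σ-fixed-point-free : ∀ d → σ d ≢ d) where

    no-short-face-cycle : ∀ d k → suc k < 5 → (closed : head G (iter φ (suc k) d) ≡ head G d) →
      ClosedWalk.VerticesDistinct (faceWalk d k closed) →
      ClosedWalk.EdgesDistinct (faceWalk d k closed) → ⊥
    no-short-face-cycle d k 1+k<5 closed vertices-distinct edges-distinct =
      girth k 1+k<5 (ClosedWalk⇒Cycle (faceWalk d k closed) vertices-distinct edges-distinct)

    head-φ≢ : ∀ d → head G d ≢ head G (φ d)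
    head-φ≢ d same =
      no-short-face-cycle d 0 (s≤s (s≤s z≤n)) (sym same) (λ { (s≤s _) () }) (λ { (s≤s _) () })

    φ-changes-edge : ∀ d → proj₁ d ≢ proj₁ (φ d)
    φ-changes-edge d same with sameEdge⇒≡∨θ {G} d (φ d) same
    ... | inj₁ φd≡d  = head-φ≢ d (cong (head G) (sym φd≡d))
    ... | inj₂ φd≡θd = σ-fixed-point-free (θ G d) φd≡θd

    head-φ²≢ : ∀ d → head G d ≢ head G (φ (φ d))
    head-φ²≢ d same = no-short-face-cycle d 1 (s≤s (s≤s (s≤s z≤n))) (sym same)
      (only-pair (λ t → head G (iter φ t d)) (head-φ≢ d))
      (only-pair (λ t → proj₁ (iter φ t d)) (φ-changes-edge d))
      where
      only-pair : ∀ {A : Set} (f : ℕ → A) → f 0 ≢ f 1 → ∀ {s t} → s < t → t ≤ 1 → f s ≢ f t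
      only-pair f f0≢f1 (s≤s z≤n)     (s≤s z≤n) = f0≢f1
      only-pair f f0≢f1 (s≤s (s≤s _)) (s≤s ())

    face-vertices-near-distinct : ∀ d {s t} → s < t → t ≤ 2 + s → head G (iter φ s d) ≢ head G (iter φ t d)
    face-vertices-near-distinct d {s} s<t t≤2+s with m≤n⇒m<n∨m≡n s<t
    ... | inj₂ refl = head-φ≢ (iter φ s d)
    ... | inj₁ 1+s<t with ≤-antisym t≤2+s 1+s<t
    ...   | refl = head-φ²≢ (iter φ s d)

    no-short-face-with-distinct-vertices : ∀ d k → 2 ≤ k → suc k < 5 → iter φ (suc k) d ≡ d →
      (∀ {s t} → s < t → t ≤ k → head G (iter φ s d) ≢ head G (iter φ t d)) → ⊥
    no-short-face-with-distinct-vertices d k 2≤k 1+k<5 φᵏd≡d vertices-distinct =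
      no-short-face-cycle d k 1+k<5 closed vertices-distinct
        (distinctVertices⇒distinctEdges (faceWalk d k closed) 2≤k vertices-distinct)
      where
      closed : head G (iter φ (suc k) d) ≡ head G d
      closed = cong (head G) φᵏd≡d

    faceLength≥5 : FaceLengthAtLeast 5
    faceLength≥5 d 0 _ φd≡d   = head-φ≢ d (cong (head G) (sym φd≡d))
    faceLength≥5 d 1 _ φ²d≡d  = head-φ²≢ d (cong (head G) (sym φ²d≡d))
    faceLength≥5 d 2 1+k<5 φ³d≡d =
      no-short-face-with-distinct-vertices d 2 (s≤s (s≤s z≤n)) 1+k<5 φ³d≡d
        (λ s<t t≤2 → face-vertices-near-distinct d s<t (≤-trans t≤2 (m≤m+n 2 _)))
    faceLength≥5 d 3 1+k<5 φ⁴d≡d =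
      no-short-face-with-distinct-vertices d 3 (s≤s (s≤s z≤n)) 1+k<5 φ⁴d≡d distinct
      where
      distinct : ∀ {s t} → s < t → t ≤ 3 → head G (iter φ s d) ≢ head G (iter φ t d)
      distinct {suc s} s<t t≤3 = face-vertices-near-distinct d s<t (≤-trans t≤3 (s≤s (s≤s (s≤s z≤n))))
      distinct {zero}  s<t t≤3 with m≤n⇒m<n∨m≡n t≤3
      ... | inj₁ t<3  = face-vertices-near-distinct d s<t (≤-pred t<3)
      -- positions 0 and 3 are adjacent through the closing step
      ... | inj₂ refl = λ same → head-φ≢ (iter φ 3 d) (trans (sym same) (cong (head G) (sym φ⁴d≡d)))
    faceLength≥5 d (suc (suc (suc (suc k)))) (s≤s (s≤s (s≤s (s≤s (s≤s ())))))

-- Size and minimum degree of the members of 𝓕 i j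

module _ (G : Graph) (e : Edge G) where

  subdivideDart : Dart G → Dart (subdivide G e)
  subdivideDart (f , false) = suc f , false
  subdivideDart (f , true) with f ≟ e
  ... | yes _ = zero , true
  ... | no  _ = suc f , true

  contractDart : Dart (subdivide G e) → Dart G
  contractDart (zero  , _) = e , true
  contractDart (suc f , b) = f , b

  contract∘subdivide : ∀ d → contractDart (subdivideDart d) ≡ d
  contract∘subdivide (f , false) = refl
  contract∘subdivide (f , true) with f ≟ e
  ... | yes refl = refl
  ... | no  _    = refl

  subdivideDart-injective : ∀ {d d'} → subdivideDart d ≡ subdivideDart d' → d ≡ d'
  subdivideDart-injective {d} {d'} eq =
    trans (sym (contract∘subdivide d)) (trans (cong contractDart eq) (contract∘subdivide d'))

  ends-subdivide-≢ : ∀ {f} → f ≢ e →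
                     ends (subdivide G e) (suc f) ≡ (suc (proj₁ (ends G f)) , suc (proj₂ (ends G f)))
  ends-subdivide-≢ {f} f≢e with f ≟ e
  ... | yes f≡e = ⊥-elim (f≢e f≡e)
  ... | no  _   = refl

  head-subdivideDart : ∀ d → head (subdivide G e) (subdivideDart d) ≡ suc (head G d)
  head-subdivideDart (f , false) with f ≟ e
  ... | yes refl = refl
  ... | no  _    = refl
  head-subdivideDart (f , true) with f ≟ e
  ... | yes refl = refl
  ... | no  f≢e  = cong proj₂ (ends-subdivide-≢ f≢e)

  subdivide-MinDegreeTwo : MinDegreeTwo G → MinDegreeTwo (subdivide G e)
  subdivide-MinDegreeTwo two zero    = (zero , false) , (suc e , true) , (λ ()) , refl , new-end
    where
    new-end : head (subdivide G e) (suc e , true) ≡ zero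
    new-end with e ≟ e
    ... | yes _   = refl
    ... | no  e≢e = ⊥-elim (e≢e refl)
  subdivide-MinDegreeTwo two (suc v) =
    TwoDartsAt-map subdivideDart suc subdivideDart-injective head-subdivideDart (two v)

circ-MinDegreeTwo : ∀ {G} e₁ e₂ a → MinDegreeTwo G → MinDegreeTwo (circ G e₁ e₂ a)
circ-MinDegreeTwo e₁ e₂ a two zero    = (zero , false) , (suc zero , false) , (λ ()) , refl , refl
circ-MinDegreeTwo {G} e₁ e₂ a two (suc v) = TwoDartsAt-map shift suc shift-injective head-shift (two₂ v)
  where
  G₁ : Graph
  G₁ = subdivide G e₁
  G₂ : Graph
  G₂ = subdivide G₁ (if does (e₁ ≟ e₂) then zero else suc e₂)
  two₂ : MinDegreeTwo G₂
  two₂ = subdivide-MinDegreeTwo G₁ _ (subdivide-MinDegreeTwo G e₁ two)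
  shift : Dart G₂ → Dart (circ G e₁ e₂ a)
  shift (f , b) = suc (suc (suc f)) , b
  shift-injective : ∀ {d d'} → shift d ≡ shift d' → d ≡ d'
  shift-injective eq =
    cong₂ _,_ (suc-injective (suc-injective (suc-injective (cong proj₁ eq)))) (cong proj₂ eq)
  head-shift : ∀ d → head (circ G e₁ e₂ a) (shift d) ≡ suc (head G₂ d)
  head-shift (f , false) = refl
  head-shift (f , true)  = refl

InF⇒MinDegreeTwo : ∀ {i j G} → InF i j G → MinDegreeTwo G
InF⇒MinDegreeTwo base zero = (zero , false) , (zero , true) , (λ ()) , refl , refl
InF⇒MinDegreeTwo (sub G∈F e _)            = subdivide-MinDegreeTwo _ e (InF⇒MinDegreeTwo G∈F)
InF⇒MinDegreeTwo (op G∈F _ e₁ e₂ a _ _)   = circ-MinDegreeTwo e₁ e₂ a (InF⇒MinDegreeTwo G∈F)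

k+[i+k*j]≡i+k*[1+j] : ∀ k i j → k + (i + k * j) ≡ i + k * suc j
k+[i+k*j]≡i+k*[1+j] = solve-∀

InF⇒vertices : ∀ {i j G} → InF i j G → n G ≡ i + 3 * j
InF⇒vertices base          = refl
InF⇒vertices (sub G∈F _ _) = cong suc (InF⇒vertices G∈F)
InF⇒vertices {i} {suc j} (op G∈F _ _ _ _ _ _) =
  trans (cong (3 +_) (InF⇒vertices G∈F)) (k+[i+k*j]≡i+k*[1+j] 3 i j)

InF⇒edges : ∀ {i j G} → InF i j G → m G ≡ i + 5 * j
InF⇒edges base          = refl
InF⇒edges (sub G∈F _ _) = cong suc (InF⇒edges G∈F)
InF⇒edges {i} {suc j} (op G∈F _ _ _ _ _ _) =
  trans (cong (5 +_) (InF⇒edges G∈F)) (k+[i+k*j]≡i+k*[1+j] 5 i j)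

euler-face-bound : ∀ {n m f c g} → n + f ≡ m + 2 * c → f * g ≤ m * 2 → g * (m + 2 * c) ≤ g * n + m * 2
euler-face-bound {n} {m} {f} {c} {g} euler f*g≤2m = begin
  g * (m + 2 * c)  ≡⟨ cong (g *_) euler ⟨
  g * (n + f)      ≡⟨ *-distribˡ-+ g n f ⟩
  g * n + g * f    ≤⟨ +-monoʳ-≤ (g * n) (subst (_≤ m * 2) (*-comm f g) f*g≤2m) ⟩
  g * n + m * 2    ∎
  where open ≤-Reasoning

counts⇒5≤i : ∀ {n m c} i j → n ≡ i + 3 * j → m ≡ i + 5 * j → 1 ≤ c →
             5 * (m + 2 * c) ≤ 5 * n + m * 2 → 5 ≤ i
counts⇒5≤i {c = c} i j refl refl 1≤c bound = *-cancelˡ-≤ 2 (≤-trans (*-monoʳ-≤ 10 1≤c) 10c≤2i)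
  where
  lhs : ∀ i j c → 5 * ((i + 5 * j) + 2 * c) ≡ (5 * i + 25 * j) + 10 * c
  lhs = solve-∀
  rhs : ∀ i j → 5 * (i + 3 * j) + (i + 5 * j) * 2 ≡ (5 * i + 25 * j) + 2 * i
  rhs = solve-∀
  10c≤2i : 10 * c ≤ 2 * i
  10c≤2i = +-cancelˡ-≤ (5 * i + 25 * j) _ _ (subst₂ _≤_ (lhs i j c) (rhs i j) bound)

lemma3p6 : (i j : ℕ) → 1 ≤ i → j ≤ i → (G : Graph) →
    InF i j G → Planar G → GirthAtLeast 5 G → 5 ≤ i
lemma3p6 i j 1≤i _ G G∈F (R , C , euler) girth =
  counts⇒5≤i i j (InF⇒vertices G∈F) (InF⇒edges G∈F) 1≤c
    (euler-face-bound {n G} {m G} {faces G R} {c} {5} euler′ (faces*g≤darts G R face-length))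
  where
  c : ℕ
  c = Components.c C
  two : MinDegreeTwo G
  two = InF⇒MinDegreeTwo G∈F
  face-length : FaceLengthAtLeast G R 5
  face-length = faceLength≥5 G R girth (MinDegreeTwo⇒σ-fixed-point-free two R)
  euler′ : n G + faces G R ≡ m G + 2 * c
  euler′ = trans (sym (+-identityʳ _))
                 (subst (λ k → n G + faces G R + k ≡ m G + 2 * c) (MinDegreeTwo⇒isolated≡0 two) euler)
  some-vertex : Vertex G
  some-vertex = fromℕ< (subst (0 <_) (sym (InF⇒vertices G∈F)) (≤-trans 1≤i (m≤m+n i _)))
  1≤c : 1 ≤ c
  1≤c = ≤-trans (s≤s z≤n) (toℕ<n (Components.label C some-vertex))
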